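{- Enf bisimilarity does not validate $\Omega$-equivalence by value: there exist two CbV $\Omega$-terms $t,u$ of Plotkin's calculus such that $t\not\simeq_{enf}u$.
   Context: Plotkin terms $t::=v\mid tu$, values $v::=x\mid\lambda x.t$; contexts $C::=\langle\cdot\rangle\mid tC\mid Ct\mid\lambda x.C$. Root rule $(\lambda x.t)v\mapsto t\{x:=v\}$ ($v$ value). Weak reduction $\to_w$: closure under $W::=\langle\cdot\rangle\mid tW\mid Wt$. Left contexts $L::=\langle\cdot\rangle\mid vL\mid Lt$; left reduction $\to_l$: closure under $L$. $t\Downarrow_ln$: $t\to_l^*n$, $n$ $\to_l$-normal. Enf simulation: $R$ such that whenever $tRt'$ one of: $t$ has no $\to_l$-normal form; $t\Downarrow_lx$ and $t'\Downarrow_lx$; $t\Downarrow_l\lambda x.t_1$, $t'\Downarrow_l\lambda x.t_1'$, $t_1Rt_1'$; $t\Downarrow_lL\langle xv\rangle$, $t'\Downarrow_lL'\langle xv'\rangle$ with $vRv'$ and $L\langle z\rangle RL'\langle z\rangle$ for $z$ not free in $L,L'$. Enf bisimilarity $\simeq_{enf}$: $t\simeq_{enf}u$ iff there is a relation $R$ with $tRu$ such that $R$ and its converse are enf simulations. Contextual preorder: $t\precsim_Cu$ iff for all contexts $C$ with $C\langle t\rangle,C\langle u\rangle$ closed, if $C\langle t\rangle$ has a $\to_w$-normal form then so does $C\langle u\rangle$. A CbV $\Omega$-term is a term contextually equivalent (both directions of $\precsim_C$) to $\Omega=\delta\delta$, $\delta=\lambda x.xx$. -}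

module Defs where

open import Data.Nat using (ℕ; zero; suc; pred; _<ᵇ_; _≡ᵇ_)
open import Data.Bool using (if_then_else_)
open import Data.Product using (Σ; _×_; ∃; _,_)
open import Data.Sum using (_⊎_)
open import Data.Empty using (⊥)
open import Relation.Nullary using (¬_)
open import Relation.Binary.PropositionalEquality using (_≡_)

-- Plotkin's untyped λ-calculus, nameless (de Bruijn) syntax.
-- Indices not bound by an enclosing λ are free variables.
data Term : Set where
  var : ℕ → Term
  lam : Term → Term
  app : Term → Term → Term

data Value : Term → Set where
  v-var : ∀ x → Value (var x)
  v-lam : ∀ t → Value (lam t)

shift : ℕ → Term → Term
shift c (var x) = if x <ᵇ c then var x else var (suc x)
shift c (lam t) = lam (shift (suc c) t)
shift c (app t u) = app (shift c t) (shift c u)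

subst : ℕ → Term → Term → Term
subst k s (var x) = if x <ᵇ k then var x else (if x ≡ᵇ k then s else var (pred x))
subst k s (lam t) = lam (subst (suc k) (shift 0 s) t)
subst k s (app t u) = app (subst k s t) (subst k s u)

Free : ℕ → Term → Set
Free x (var y) = x ≡ y
Free x (lam t) = Free (suc x) t
Free x (app t u) = Free x t ⊎ Free x u

Closed : Term → Set
Closed t = ∀ x → ¬ Free x t

data _↦_ : Term → Term → Set where
  βv : ∀ t v → Value v → app (lam t) v ↦ subst 0 v t

data _→w_ : Term → Term → Set where
  w-root : ∀ {t u} → t ↦ u → t →w u
  w-appR : ∀ {t u u'} → u →w u' → app t u →w app t u'
  w-appL : ∀ {t t' u} → t →w t' → app t u →w app t' u

data _→l_ : Term → Term → Set where
  l-root : ∀ {t u} → t ↦ u → t →l u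
  l-appR : ∀ {v u u'} → Value v → u →l u' → app v u →l app v u'
  l-appL : ∀ {t t' u} → t →l t' → app t u →l app t' u

data Star (R : Term → Term → Set) : Term → Term → Set where
  ε   : ∀ {t} → Star R t t
  _◅_ : ∀ {t u s} → R t u → Star R u s → Star R t s

NormalW : Term → Set
NormalW n = ¬ (∃ λ n' → n →w n')

NormalL : Term → Set
NormalL n = ¬ (∃ λ n' → n →l n')

HasWNF : Term → Set
HasWNF t = ∃ λ n → Star _→w_ t n × NormalW n

_⇓l_ : Term → Term → Set
t ⇓l n = Star _→l_ t n × NormalL n

data LCtx : Set where
  hole : LCtx
  vL   : ∀ v → Value v → LCtx → LCtx
  Lt   : LCtx → Term → LCtx

plugL : LCtx → Term → Term
plugL hole s = s
plugL (vL v _ L) s = app v (plugL L s)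
plugL (Lt L t) s = app (plugL L s) t

FreeL : ℕ → LCtx → Set
FreeL z hole = ⊥
FreeL z (vL v _ L) = Free z v ⊎ FreeL z L
FreeL z (Lt L t) = FreeL z L ⊎ Free z t

EnfSim : (Term → Term → Set) → Set
EnfSim R = ∀ t t' → R t t' →
    (¬ (∃ λ n → t ⇓l n))
  ⊎ (∃ λ x → t ⇓l var x × t' ⇓l var x)
  ⊎ (∃ λ t₁ → ∃ λ t₁' → t ⇓l lam t₁ × t' ⇓l lam t₁' × R t₁ t₁')
  ⊎ (∃ λ L → ∃ λ L' → ∃ λ x → ∃ λ v → ∃ λ v' →
        Value v × Value v'
      × t ⇓l plugL L (app (var x) v) × t' ⇓l plugL L' (app (var x) v')
      × R v v'
      × (∃ λ z → ¬ FreeL z L × ¬ FreeL z L' × R (plugL L (var z)) (plugL L' (var z))))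

Converse : (Term → Term → Set) → Term → Term → Set
Converse R t u = R u t

_≃enf_ : Term → Term → Set₁
t ≃enf u = Σ (Term → Term → Set) λ R → R t u × EnfSim R × EnfSim (Converse R)

-- general contexts C ::= ⟨·⟩ | tC | Ct | λx.C   (plugging may capture)
data Ctx : Set where
  hole : Ctx
  tC   : Term → Ctx → Ctx
  Ct   : Ctx → Term → Ctx
  λC   : Ctx → Ctx

plug : Ctx → Term → Term
plug hole s = s
plug (tC t C) s = app t (plug C s)
plug (Ct C t) s = app (plug C s) t
plug (λC C) s = lam (plug C s)

_≾C_ : Term → Term → Set
t ≾C u = ∀ C → Closed (plug C t) → Closed (plug C u) → HasWNF (plug C t) → HasWNF (plug C u)

δ : Term
δ = lam (app (var 0) (var 0))

Ω : Term
Ω = app δ δ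

OmegaTerm : Term → Set
OmegaTerm t = t ≾C Ω × Ω ≾C t

-- Take t = Ω and u = x x Ω. Weak reduction may reduce under any application,
-- so a term of the form W⟨Ω⟩ only ever reduces to terms of that form and never
-- reaches a normal form; replacing such subterms by one another is therefore a
-- simulation for weak reduction, which makes any two W⟨Ω⟩-terms contextually
-- equivalent. Left reduction, however, does not evaluate the argument of the
-- stuck application x x, so x x Ω is left-normal while Ω has no left normal
-- form, and an enf simulation from x x Ω to Ω cannot exist.
module Submission where

open import Defs
open import Data.Product using (∃; _×_; _,_; proj₂)
open import Data.Sum using (inj₁; inj₂)
open import Data.Empty using (⊥-elim)
open import Data.Nat using (suc; _<ᵇ_; _≡ᵇ_)
open import Data.Bool using (true; false)
open import Relation.Nullary using (¬_)
open import Relation.Binary.PropositionalEquality using (_≡_; refl)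

star-map : ∀ {R S : Term → Term → Set} (f : Term → Term) →
           (∀ {a b} → R a b → S (f a) (f b)) →
           ∀ {a b} → Star R a b → Star S (f a) (f b)
star-map f g ε       = ε
star-map f g (r ◅ p) = g r ◅ star-map f g p

star-++ : ∀ {R : Term → Term → Set} {a b c} → Star R a b → Star R b c → Star R a c
star-++ ε       q = q
star-++ (r ◅ p) q = r ◅ star-++ p q

lam-→w-normal : ∀ {t m} → ¬ (lam t →w m)
lam-→w-normal (w-root ())

var-→w-normal : ∀ {x m} → ¬ (var x →w m)
var-→w-normal (w-root ())

data WΩ : Term → Set where
  ⟨Ω⟩ : WΩ Ω
  Wt  : ∀ {s t} → WΩ s → WΩ (app s t)
  tW  : ∀ {s t} → WΩ t → WΩ (app s t)

WΩ-nonvalue : ∀ {v} → Value v → ¬ WΩ v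
WΩ-nonvalue (v-var _) ()
WΩ-nonvalue (v-lam _) ()

WΩ-shift : ∀ c {s} → WΩ s → WΩ (shift c s)
WΩ-shift c ⟨Ω⟩    = ⟨Ω⟩
WΩ-shift c (Wt w) = Wt (WΩ-shift c w)
WΩ-shift c (tW w) = tW (WΩ-shift c w)

WΩ-subst : ∀ k v {s} → WΩ s → WΩ (subst k v s)
WΩ-subst k v ⟨Ω⟩    = ⟨Ω⟩
WΩ-subst k v (Wt w) = Wt (WΩ-subst k v w)
WΩ-subst k v (tW w) = tW (WΩ-subst k v w)

WΩ-→w : ∀ {s s'} → WΩ s → s →w s' → WΩ s'
WΩ-→w ⟨Ω⟩    (w-root (βv _ _ _))   = ⟨Ω⟩
WΩ-→w ⟨Ω⟩    (w-appR st)           = ⊥-elim (lam-→w-normal st)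
WΩ-→w ⟨Ω⟩    (w-appL st)           = ⊥-elim (lam-→w-normal st)
WΩ-→w (Wt ()) (w-root (βv _ _ _))
WΩ-→w (Wt w) (w-appR _)            = Wt w
WΩ-→w (Wt w) (w-appL st)           = Wt (WΩ-→w w st)
WΩ-→w (tW w) (w-root (βv _ _ val)) = ⊥-elim (WΩ-nonvalue val w)
WΩ-→w (tW w) (w-appR st)           = tW (WΩ-→w w st)
WΩ-→w (tW w) (w-appL _)            = tW w

WΩ-reducible : ∀ {s} → WΩ s → ∃ λ s' → s →w s'
WΩ-reducible ⟨Ω⟩ = Ω , w-root (βv _ _ (v-lam _))
WΩ-reducible (Wt w) with WΩ-reducible w
... | _ , st = _ , w-appL st
WΩ-reducible (tW w) with WΩ-reducible w
... | _ , st = _ , w-appR st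

data _≈Ω_ : Term → Term → Set where
  ≈WΩ  : ∀ {s s'} → WΩ s → WΩ s' → s ≈Ω s'
  ≈var : ∀ {x} → var x ≈Ω var x
  ≈lam : ∀ {a a'} → a ≈Ω a' → lam a ≈Ω lam a'
  ≈app : ∀ {a a' b b'} → a ≈Ω a' → b ≈Ω b' → app a b ≈Ω app a' b'

≈Ω-refl : ∀ t → t ≈Ω t
≈Ω-refl (var x)   = ≈var
≈Ω-refl (lam t)   = ≈lam (≈Ω-refl t)
≈Ω-refl (app t u) = ≈app (≈Ω-refl t) (≈Ω-refl u)

≈Ω-sym : ∀ {s s'} → s ≈Ω s' → s' ≈Ω s
≈Ω-sym (≈WΩ w w') = ≈WΩ w' w
≈Ω-sym ≈var       = ≈var
≈Ω-sym (≈lam e)   = ≈lam (≈Ω-sym e)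
≈Ω-sym (≈app e f) = ≈app (≈Ω-sym e) (≈Ω-sym f)

≈Ω-plug : ∀ C {s s'} → s ≈Ω s' → plug C s ≈Ω plug C s'
≈Ω-plug hole     e = e
≈Ω-plug (tC t C) e = ≈app (≈Ω-refl t) (≈Ω-plug C e)
≈Ω-plug (Ct C t) e = ≈app (≈Ω-plug C e) (≈Ω-refl t)
≈Ω-plug (λC C)   e = ≈lam (≈Ω-plug C e)

≈Ω-shift : ∀ c {a a'} → a ≈Ω a' → shift c a ≈Ω shift c a'
≈Ω-shift c (≈WΩ w w')  = ≈WΩ (WΩ-shift c w) (WΩ-shift c w')
≈Ω-shift c (≈var {x})  = ≈Ω-refl (shift c (var x))
≈Ω-shift c (≈lam e)    = ≈lam (≈Ω-shift (suc c) e)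
≈Ω-shift c (≈app e f)  = ≈app (≈Ω-shift c e) (≈Ω-shift c f)

≈Ω-subst : ∀ k {v v' a a'} → v ≈Ω v' → a ≈Ω a' → subst k v a ≈Ω subst k v' a'
≈Ω-subst k ev (≈WΩ w w') = ≈WΩ (WΩ-subst k _ w) (WΩ-subst k _ w')
≈Ω-subst k ev (≈var {x}) with x <ᵇ k
... | true = ≈var
... | false with x ≡ᵇ k
...   | true  = ev
...   | false = ≈var
≈Ω-subst k ev (≈lam e)   = ≈lam (≈Ω-subst (suc k) (≈Ω-shift 0 ev) e)
≈Ω-subst k ev (≈app e f) = ≈app (≈Ω-subst k ev e) (≈Ω-subst k ev f)

≈Ω-value : ∀ {v v'} → Value v → v ≈Ω v' → Value v'
≈Ω-value val (≈WΩ w _) = ⊥-elim (WΩ-nonvalue val w)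
≈Ω-value _   ≈var      = v-var _
≈Ω-value _   (≈lam _)  = v-lam _

≈Ω-simulates-→w : ∀ {s s' s₁} → s ≈Ω s' → s →w s₁ →
                  ∃ λ s₁' → Star _→w_ s' s₁' × s₁ ≈Ω s₁'
≈Ω-simulates-→w (≈WΩ w w') st = _ , ε , ≈WΩ (WΩ-→w w st) w'
≈Ω-simulates-→w ≈var       st = ⊥-elim (var-→w-normal st)
≈Ω-simulates-→w (≈lam _)   st = ⊥-elim (lam-→w-normal st)
≈Ω-simulates-→w (≈app (≈WΩ () _) _) (w-root (βv _ _ _))
≈Ω-simulates-→w (≈app (≈lam ea) eb) (w-root (βv _ _ val)) =
  _ , w-root (βv _ _ (≈Ω-value val eb)) ◅ ε , ≈Ω-subst 0 eb ea
≈Ω-simulates-→w (≈app ea eb) (w-appR st) with ≈Ω-simulates-→w eb st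
... | _ , steps , e = _ , star-map (app _) w-appR steps , ≈app ea e
≈Ω-simulates-→w (≈app ea eb) (w-appL st) with ≈Ω-simulates-→w ea st
... | _ , steps , e = _ , star-map (λ a → app a _) w-appL steps , ≈app e eb

≈Ω-simulates-→w* : ∀ {s s' n} → s ≈Ω s' → Star _→w_ s n →
                   ∃ λ n' → Star _→w_ s' n' × n ≈Ω n'
≈Ω-simulates-→w* e ε = _ , ε , e
≈Ω-simulates-→w* e (st ◅ p) with ≈Ω-simulates-→w e st
... | _ , steps , e₁ with ≈Ω-simulates-→w* e₁ p
...   | _ , steps₁ , e₂ = _ , star-++ steps steps₁ , e₂

≈Ω-reflects-→w : ∀ {n n' m} → n ≈Ω n' → n' →w m → ∃ λ k → n →w k
≈Ω-reflects-→w (≈WΩ w _) _  = WΩ-reducible w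
≈Ω-reflects-→w ≈var      st = ⊥-elim (var-→w-normal st)
≈Ω-reflects-→w (≈lam _)  st = ⊥-elim (lam-→w-normal st)
≈Ω-reflects-→w (≈app (≈WΩ _ ()) _) (w-root (βv _ _ _))
≈Ω-reflects-→w (≈app (≈lam _) eb) (w-root (βv _ _ val)) =
  _ , w-root (βv _ _ (≈Ω-value val (≈Ω-sym eb)))
≈Ω-reflects-→w (≈app ea eb) (w-appR st) with ≈Ω-reflects-→w eb st
... | _ , st' = _ , w-appR st'
≈Ω-reflects-→w (≈app ea eb) (w-appL st) with ≈Ω-reflects-→w ea st
... | _ , st' = _ , w-appL st'

≈Ω-preserves-HasWNF : ∀ {s s'} → s ≈Ω s' → HasWNF s → HasWNF s'
≈Ω-preserves-HasWNF e (n , steps , normal) with ≈Ω-simulates-→w* e steps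
... | n' , steps' , en = n' , steps' , λ (_ , st) → normal (≈Ω-reflects-→w en st)

WΩ-≾C : ∀ {t u} → WΩ t → WΩ u → t ≾C u
WΩ-≾C wt wu C _ _ = ≈Ω-preserves-HasWNF (≈Ω-plug C (≈WΩ wt wu))

WΩ-OmegaTerm : ∀ {t} → WΩ t → OmegaTerm t
WΩ-OmegaTerm w = WΩ-≾C w ⟨Ω⟩ , WΩ-≾C ⟨Ω⟩ w

Ω-→l : ∀ {m} → Ω →l m → m ≡ Ω
Ω-→l (l-root (βv _ _ _))   = refl
Ω-→l (l-appR _ (l-root ()))
Ω-→l (l-appL (l-root ()))

Ω-→l* : ∀ {n} → Star _→l_ Ω n → n ≡ Ω
Ω-→l* ε = refl
Ω-→l* (st ◅ p) with Ω-→l st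
... | refl = Ω-→l* p

Ω-no-⇓l : ∀ {n} → ¬ (Ω ⇓l n)
Ω-no-⇓l (steps , normal) with Ω-→l* steps
... | refl = normal (Ω , l-root (βv _ _ (v-lam _)))

EnfSim-preserves-⇓l : ∀ {R t t'} → EnfSim R → R t t' →
                      (∃ λ n → t ⇓l n) → ∃ λ n' → t' ⇓l n'
EnfSim-preserves-⇓l sim r conv with sim _ _ r
... | inj₁ diverges = ⊥-elim (diverges conv)
... | inj₂ (inj₁ (_ , _ , h)) = _ , h
... | inj₂ (inj₂ (inj₁ (_ , _ , _ , h , _))) = _ , h
... | inj₂ (inj₂ (inj₂ (_ , _ , _ , _ , _ , _ , _ , _ , h , _))) = _ , h

xxΩ : Term
xxΩ = app (app (var 0) (var 0)) Ω

xxΩ-→l-normal : NormalL xxΩ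
xxΩ-→l-normal (_ , l-root ())
xxΩ-→l-normal (_ , l-appR () _)
xxΩ-→l-normal (_ , l-appL (l-root ()))
xxΩ-→l-normal (_ , l-appL (l-appR _ (l-root ())))
xxΩ-→l-normal (_ , l-appL (l-appL (l-root ())))

Ω-≄enf-xxΩ : ¬ (Ω ≃enf xxΩ)
Ω-≄enf-xxΩ (R , r , _ , converseSim) =
  Ω-no-⇓l (proj₂ (EnfSim-preserves-⇓l converseSim r (xxΩ , ε , xxΩ-→l-normal)))

proposition8p6 : ∃ λ t → ∃ λ u → OmegaTerm t × OmegaTerm u × ¬ (t ≃enf u)
proposition8p6 = Ω , xxΩ , WΩ-OmegaTerm ⟨Ω⟩ , WΩ-OmegaTerm (tW ⟨Ω⟩) , Ω-≄enf-xxΩ
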